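{- Let $T$ be a tree, $H$ a graph, and let $V_1,V_2$ be a partition of $V(T(H))$. Let $L\subseteq V(H)$ with $|L|=t$, and suppose there are two copies $H_1,H_2$ of $H$ in $T(H)$ such that for every $u\in L$ the copies of $u$ in $H_1$ and in $H_2$ belong to different partition classes. Then $T(H)$ has a matching of size $t$ each of whose edges has one end in $V_1$ and the other in $V_2$.
   Context: For a tree $T$ and a graph $H$, $T(H)$ is the graph consisting of disjoint copies $H_t$ of $H$, one for each $t\in V(T)$, where for every edge $\{t_1,t_2\}$ of $T$ and every $u\in V(H)$ the copy of $u$ in $H_{t_1}$ is joined to the copy of $u$ in $H_{t_2}$. -}

module Defs where

open import Data.Nat using (ℕ; suc; _≤_)
open import Data.Fin using (Fin; zero; suc; inject₁; fromℕ; _≟_)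
open import Data.Fin.Subset using (Subset; _∈_; ∣_∣)
open import Data.Bool using (Bool)
open import Data.Product using (Σ; _×_; _,_; proj₁; proj₂)
open import Data.Sum using (_⊎_)
open import Relation.Nullary using (¬_)
open import Relation.Binary.PropositionalEquality using (_≡_; _≢_)
open import Function.Definitions using (Injective)

record Graph : Set₁ where
  field
    n      : ℕ
    Adj    : Fin n → Fin n → Set
    sym    : ∀ {u v} → Adj u v → Adj v u
    irrefl : ∀ {u} → ¬ Adj u u

open Graph public

data Walk (G : Graph) : Fin (n G) → Fin (n G) → Set where
  []  : ∀ {u} → Walk G u u
  _∷_ : ∀ {u v w} → Adj G u v → Walk G v w → Walk G u w

Connected : Graph → Set
Connected G = ∀ (u v : Fin (n G)) → Walk G u v

record Cycle (G : Graph) : Set where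
  field
    k     : ℕ
    2≤k   : 2 ≤ k
    c     : Fin (suc k) → Fin (n G)
    inj   : Injective _≡_ _≡_ c
    steps : ∀ (i : Fin k) → Adj G (c (inject₁ i)) (c (suc i))
    close : Adj G (c (fromℕ k)) (c zero)

Acyclic : Graph → Set
Acyclic G = ¬ Cycle G

IsTree : Graph → Set
IsTree G = Connected G × Acyclic G

-- The graph T(H): vertex (s , u) is the copy of u ∈ V(H) in the copy H_s.
-- (s , u) ~ (s' , u') iff (s ≡ s' and u ~_H u') or (s ~_T s' and u ≡ u').
TH-V : Graph → Graph → Set
TH-V T H = Fin (n T) × Fin (n H)

TH-Adj : (T H : Graph) → TH-V T H → TH-V T H → Set
TH-Adj T H (s , u) (s' , u') = (s ≡ s' × Adj H u u') ⊎ (Adj T s s' × u ≡ u')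

-- A matching of size t in T(H) all of whose edges join V₁ to V₂, where the
-- partition (V₁ , V₂) is given by a colouring χ (V₁ = χ⁻¹ true, V₂ = χ⁻¹ false).
record CrossMatching (T H : Graph) (χ : TH-V T H → Bool) (t : ℕ) : Set where
  field
    edge     : Fin t → TH-V T H × TH-V T H
    isEdge   : ∀ i → TH-Adj T H (proj₁ (edge i)) (proj₂ (edge i))
    crossing : ∀ i → χ (proj₁ (edge i)) ≢ χ (proj₂ (edge i))
    disjoint : ∀ i j → i ≢ j →
               proj₁ (edge i) ≢ proj₁ (edge j) × proj₁ (edge i) ≢ proj₂ (edge j) ×
               proj₂ (edge i) ≢ proj₁ (edge j) × proj₂ (edge i) ≢ proj₂ (edge j)

-- Only the connectivity of T matters. For u ∈ L, the colour of (s , u) differs at s₁ and s₂,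
-- so it changes along some edge {a , b} of a walk from s₁ to s₂ in T; the edge joining
-- (a , u) to (b , u) in T(H) is then bichromatic. These edges, one per u ∈ L, lie in
-- different copies of T (the fibres over distinct u) and so form a matching.
module Submission where

open import Defs
open import Data.Nat using (ℕ)
open import Data.Fin using (Fin; zero; suc)
open import Data.Fin.Properties using (suc-injective)
open import Data.Fin.Subset using (Subset; _∈_; ∣_∣; inside; outside)
open import Data.Vec using (_∷_; here; there)
open import Data.Bool using (Bool)
open import Data.Bool.Properties using () renaming (_≟_ to _≟ᵇ_)
open import Data.Product using (_,_; proj₂)
open import Data.Sum using (inj₂)
open import Data.Empty using (⊥-elim)
open import Function.Definitions using (Injective)
open import Relation.Nullary using (yes; no)
open import Relation.Binary.Definitions using (DecidableEquality)
open import Relation.Binary.PropositionalEquality using (_≡_; _≢_; refl; trans; cong)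

enumerate : ∀ {m} (p : Subset m) → Fin ∣ p ∣ → Fin m
enumerate (inside  ∷ p) zero    = zero
enumerate (inside  ∷ p) (suc i) = suc (enumerate p i)
enumerate (outside ∷ p) i       = suc (enumerate p i)

enumerate-∈ : ∀ {m} (p : Subset m) (i : Fin ∣ p ∣) → enumerate p i ∈ p
enumerate-∈ (inside  ∷ p) zero    = here
enumerate-∈ (inside  ∷ p) (suc i) = there (enumerate-∈ p i)
enumerate-∈ (outside ∷ p) i       = there (enumerate-∈ p i)

enumerate-injective : ∀ {m} (p : Subset m) → Injective _≡_ _≡_ (enumerate p)
enumerate-injective (inside  ∷ p) {zero}  {zero}  _  = refl
enumerate-injective (inside  ∷ p) {suc i} {suc j} eq =
  cong suc (enumerate-injective p (suc-injective eq))
enumerate-injective (outside ∷ p) eq = enumerate-injective p (suc-injective eq)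

record BichromaticEdge {A : Set} (G : Graph) (f : Fin (n G) → A) : Set where
  field
    from to : Fin (n G)
    adj     : Adj G from to
    differ  : f from ≢ f to

walk⇒bichromaticEdge : ∀ {A : Set} → DecidableEquality A →
                       (G : Graph) (f : Fin (n G) → A) {x y : Fin (n G)} →
                       Walk G x y → f x ≢ f y → BichromaticEdge G f
walk⇒bichromaticEdge _≟_ G f [] fx≢fy = ⊥-elim (fx≢fy refl)
walk⇒bichromaticEdge _≟_ G f {x} (_∷_ {v = v} x~v w) fx≢fy with f x ≟ f v
... | yes fx≡fv = walk⇒bichromaticEdge _≟_ G f w (λ fv≡fy → fx≢fy (trans fx≡fv fv≡fy))
... | no  fx≢fv = record { from = x ; to = v ; adj = x~v ; differ = fx≢fv }

fibreEdges⇒crossMatching : (T H : Graph) (χ : TH-V T H → Bool) {t : ℕ}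
                           (u : Fin t → Fin (n H)) → Injective _≡_ _≡_ u →
                           (∀ i → BichromaticEdge T (λ s → χ (s , u i))) →
                           CrossMatching T H χ t
fibreEdges⇒crossMatching T H χ u u-injective e = record
  { edge     = λ i → (from (e i) , u i) , (to (e i) , u i)
  ; isEdge   = λ i → inj₂ (adj (e i) , refl)
  ; crossing = λ i → differ (e i)
  ; disjoint = λ i j i≢j →
      let apart = fibresApart i≢j in apart , apart , apart , apart
  }
  where
  open BichromaticEdge
  fibresApart : ∀ {i j} → i ≢ j → ∀ {a b} → (a , u i) ≢ (b , u j)
  fibresApart i≢j q = i≢j (u-injective (cong proj₂ q))

lemma12 : (T H : Graph) → IsTree T →
          (χ : TH-V T H → Bool) →
          (t : ℕ) (L : Subset (n H)) → ∣ L ∣ ≡ t →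
          (s₁ s₂ : Fin (n T)) →
          (∀ u → u ∈ L → χ (s₁ , u) ≢ χ (s₂ , u)) →
          CrossMatching T H χ t
lemma12 T H (connected , _) χ .(∣ L ∣) L refl s₁ s₂ separated =
  fibreEdges⇒crossMatching T H χ (enumerate L) (enumerate-injective L) edgeIn
  where
  edgeIn : ∀ i → BichromaticEdge T (λ s → χ (s , enumerate L i))
  edgeIn i = walk⇒bichromaticEdge _≟ᵇ_ T (λ s → χ (s , enumerate L i)) (connected s₁ s₂)
                                  (separated (enumerate L i) (enumerate-∈ L i))
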